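{- Let $q,q'$ be integers with $q'>q>1$ and $q'\ge 2q-1$, and let $n>1$. Let $S=(s_i)$ be an $\mathcal{OS}_q(n)$ with ring sequence $[s_0,\ldots,s_{m-1}]$, and let $S'$ be the sequence over $\mathbb{Z}_{q'}$ with ring sequence $[s'_0,\ldots,s'_{m-1}]$, where for $x\in\mathbb{Z}_q$, $x'$ denotes the residue class in $\mathbb{Z}_{q'}$ of the unique integer in $\{0,1,\ldots,q-1\}$ representing $x$. Then $S'$ is an $\mathcal{SOS}_{q'}(n)$.
   Context: All sequences are periodic with entries in $\mathbb{Z}_q$ (or $\mathbb{Z}_{q'}$). A periodic sequence $S=(s_i)$ of period $m$ is described by its ring sequence $[s_0,\ldots,s_{m-1}]$. Write $\mathbf{s}_n(i)=(s_i,\ldots,s_{i+n-1})$; for an $n$-tuple $\mathbf{u}=(u_0,\ldots,u_{n-1})$, $\mathbf{u}^R=(u_{n-1},\ldots,u_0)$ and $-\mathbf{u}=(-u_0,\ldots,-u_{n-1})$. $S$ is an $n$-window sequence if $\mathbf{s}_n(i)=\mathbf{s}_n(j)$ implies $i\equiv j\pmod m$. An $\mathcal{OS}_q(n)$ (orientable sequence of order $n$) is an $n$-window sequence over $\mathbb{Z}_q$ with $\mathbf{s}_n(i)\neq\mathbf{s}_n(j)^R$ for all $i,j$. An $\mathcal{SOS}_q(n)$ (special orientable sequence) is an $\mathcal{OS}_q(n)$ which also satisfies $\mathbf{s}_n(i)\neq-\mathbf{s}_n(j)^R$ for all $i,j$. -}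

module Defs where

open import Data.Nat using (ℕ; suc; _+_; _∸_; NonZero)
open import Data.Nat.DivMod using (_%_)
open import Data.Fin using (Fin; toℕ; fromℕ<; opposite)
open import Data.Nat.DivMod using (m%n<n)
open import Relation.Binary.PropositionalEquality using (_≡_; _≢_)

-- A periodic sequence over ℤ_q of period m, given by its ring sequence
-- [s_0, …, s_{m-1}]; ℤ_q is represented by Fin q (residues 0..q-1).
RingSeq : (q m : ℕ) → Set
RingSeq q m = Fin m → Fin q

Tuple : (q n : ℕ) → Set
Tuple q n = Fin n → Fin q

_⊕_ : {m : ℕ} .{{_ : NonZero m}} → Fin m → ℕ → Fin m
_⊕_ {m} i j = fromℕ< (m%n<n (toℕ i + j) m)

window : {q m : ℕ} .{{_ : NonZero m}} (n : ℕ) → RingSeq q m → Fin m → Tuple q n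
window n s i k = s (i ⊕ toℕ k)

rev : {q n : ℕ} → Tuple q n → Tuple q n
rev u k = u (opposite k)

negℤ : {q : ℕ} → Fin q → Fin q
negℤ {suc q} x = fromℕ< (m%n<n (suc q ∸ toℕ x) (suc q))

negT : {q n : ℕ} → Tuple q n → Tuple q n
negT u k = negℤ (u k)

_≐_ : {q n : ℕ} → Tuple q n → Tuple q n → Set
u ≐ v = ∀ k → u k ≡ v k

IsWindow : {q m : ℕ} .{{_ : NonZero m}} (n : ℕ) → RingSeq q m → Set
IsWindow n s = ∀ i j → window n s i ≐ window n s j → i ≡ j

IsOS : {q m : ℕ} .{{_ : NonZero m}} (n : ℕ) → RingSeq q m → Set
IsOS n s = IsWindow n s × (∀ i j → (window n s i ≐ rev (window n s j)) → ⊥)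
  where open import Data.Product using (_×_)
        open import Data.Empty using (⊥)

IsSOS : {q m : ℕ} .{{_ : NonZero m}} (n : ℕ) → RingSeq q m → Set
IsSOS n s = IsOS n s × (∀ i j → (window n s i ≐ negT (rev (window n s j))) → ⊥)
  where open import Data.Product using (_×_)
        open import Data.Empty using (⊥)

{-# OPTIONS --safe #-}
-- The embedding x ↦ x′ of ℤ_q into ℤ_q′ is injective, so windows of S′ that
-- agree (possibly after reversal) come from windows of S that agree, and S′
-- inherits the OS property.  For the SOS property, x′ = −y′ means that
-- x + y ≡ 0 (mod q′) where x + y ≤ 2q − 2 < q′; so x = y = 0, and a match of a
-- window with the negated reversal of another is already a match with its
-- reversal, which S forbids.
module Submission where

open import Defs
open import Data.Nat using (ℕ; _<_; _≤_; _∸_; _*_; NonZero; suc; _+_; _%_; s≤s)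
open import Data.Fin using (Fin; inject≤; zero; suc; toℕ)
open import Data.Nat.Properties
open import Data.Nat.DivMod using (n%n≡0; m<n⇒m%n≡m)
open import Data.Fin.Properties using (toℕ<n; toℕ-fromℕ<; toℕ-inject≤; toℕ-injective; inject≤-injective)
open import Data.Product using (_,_)
open import Function using (_∘_)
open import Function.Definitions using (Injective)
open import Relation.Nullary using (contradiction)
open import Relation.Binary.PropositionalEquality
open ≡-Reasoning

negℤ-zero : ∀ {p} → negℤ {suc p} zero ≡ zero
negℤ-zero {p} = toℕ-injective (trans (toℕ-fromℕ< _) (n%n≡0 (suc p)))

toℕ-negℤ-suc+toℕ-suc : ∀ {p} (y : Fin p) → toℕ (negℤ {suc p} (suc y)) + toℕ (suc y) ≡ suc p
toℕ-negℤ-suc+toℕ-suc {p} y = begin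
  toℕ (negℤ (suc y)) + suc (toℕ y) ≡⟨ cong (_+ suc (toℕ y)) (toℕ-fromℕ< _) ⟩
  (p ∸ toℕ y) % suc p + suc (toℕ y) ≡⟨ cong (_+ suc (toℕ y)) (m<n⇒m%n≡m (s≤s (m∸n≤m p (toℕ y)))) ⟩
  p ∸ toℕ y + suc (toℕ y)           ≡⟨ +-suc (p ∸ toℕ y) (toℕ y) ⟩
  suc (p ∸ toℕ y + toℕ y)           ≡⟨ cong suc (m∸n+n≡m (<⇒≤ (toℕ<n y))) ⟩
  suc p                             ∎

≡negℤ⇒≡ : ∀ {q} (x y : Fin q) → toℕ x + toℕ y < q → x ≡ negℤ y → x ≡ y
≡negℤ⇒≡ {suc p} x zero    _  x≡-y = trans x≡-y negℤ-zero
≡negℤ⇒≡ {suc p} x (suc y) lt x≡-y = contradiction lt (<-irrefl sum≡q)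
  where
  sum≡q : toℕ x + toℕ (suc y) ≡ suc p
  sum≡q = trans (cong (λ z → toℕ z + toℕ (suc y)) x≡-y) (toℕ-negℤ-suc+toℕ-suc y)

toℕ+toℕ<2*n∸1 : ∀ {n} (x y : Fin n) → toℕ x + toℕ y < 2 * n ∸ 1
toℕ+toℕ<2*n∸1 {suc k} x y =
  subst (toℕ x + toℕ y <_) (trans (+-comm (suc k) k) (cong (k +_) (sym (+-identityʳ (suc k)))))
        (+-mono-<-≤ (toℕ<n x) (≤-pred (toℕ<n y)))

inject≤-≡negℤ⇒≡ : ∀ {q q′} (q≤q′ : q ≤ q′) → 2 * q ∸ 1 ≤ q′ → (x y : Fin q) →
                  inject≤ x q≤q′ ≡ negℤ (inject≤ y q≤q′) → x ≡ y
inject≤-≡negℤ⇒≡ {q′ = q′} q≤q′ 2q∸1≤q′ x y x′≡-y′ =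
  inject≤-injective q≤q′ q≤q′ x y (≡negℤ⇒≡ _ _ sum<q′ x′≡-y′)
  where
  sum<q′ : toℕ (inject≤ x q≤q′) + toℕ (inject≤ y q≤q′) < q′
  sum<q′ = subst (_< q′) (sym (cong₂ _+_ (toℕ-inject≤ x q≤q′) (toℕ-inject≤ y q≤q′)))
                 (≤-trans (toℕ+toℕ<2*n∸1 x y) 2q∸1≤q′)

module _ {q q′ m : ℕ} .{{_ : NonZero m}} {n : ℕ} {f : Fin q → Fin q′}
         (f-injective : Injective _≡_ _≡_ f) {s : RingSeq q m} where

  IsWindow-map : IsWindow n s → IsWindow n (f ∘ s)
  IsWindow-map win i j e = win i j (f-injective ∘ e)

  IsOS-map : IsOS n s → IsOS n (f ∘ s)
  IsOS-map (win , no-rev) = IsWindow-map win , λ i j e → no-rev i j (f-injective ∘ e)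

theorem3p2 : (q q′ n m : ℕ) .{{_ : NonZero m}} →
    1 < q → q < q′ → 2 * q ∸ 1 ≤ q′ → 1 < n →
    (q≤q′ : q ≤ q′) → (s : RingSeq q m) → IsOS n s →
    IsSOS n (λ i → inject≤ (s i) q≤q′)
theorem3p2 q q′ n m _ _ 2q∸1≤q′ _ q≤q′ s os@(_ , no-rev) =
  IsOS-map (inject≤-injective q≤q′ q≤q′ _ _) {s} os ,
  λ i j e → no-rev i j (λ k → inject≤-≡negℤ⇒≡ q≤q′ 2q∸1≤q′ _ _ (e k))
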